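{- Let $\Phi\in\{B_n,C_n,D_n\}$, let $\mathcal T$ be a Coxeter tournament on the complete signed graph $\mathcal K_\Phi$, and let $\mathcal I\subseteq\mathcal T$ be a neutral sub-tournament with $\ell\ge3$ games. Then $\mathcal I$ can be reversed by a series of at most $\ell-2$ type-$\Phi$ generator reversals; that is, there are tournaments $\mathcal T=\mathcal T^{0},\mathcal T^{1},\dots,\mathcal T^{m}=\mathcal T*\mathcal I$ with $m\le\ell-2$ such that each $\mathcal T^{k+1}=\mathcal T^{k}*\mathcal G_k$ for some copy $\mathcal G_k$ of a type-$\Phi$ generator in $\mathcal T^{k}$.
   Context: Vectors: $\mathbf e^{\pm}_{ij}=\mathbf e_i\pm\mathbf e_j$ (for $i>j$), $\mathbf e^h_i=\mathbf e_i$, $\mathbf e^\ell_i=2\mathbf e_i$ for negative edges $e^-_{ij}$, positive edges $e^+_{ij}$, half edges $e^h_i$ and loops $e^\ell_i$. $\mathcal K_{D_n}$ contains all negative and positive edges on $[n]$ (one of each per pair); $\mathcal K_{B_n}$ these plus all half edges; $\mathcal K_{C_n}$ all negative and positive edges plus all loops. A Coxeter tournament on a signed graph is a family $(w_e)$, $w_e\in\{0,1\}$, indexed by its edges (games). A sub-tournament is the restriction to a subset of games; it is neutral if $\sum(w_e-\frac12)\mathbf e=\mathbf 0$ over its games. $\mathcal T*\mathcal X$ flips $w_e\mapsto1-w_e$ for games of $\mathcal X$. A copy of a type-$\Phi$ generator in $\mathcal T$ is a neutral sub-tournament whose games are: (a) (all types) three negative edges pairwise joining three distinct vertices, or one negative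 and two positive edges pairwise joining three distinct vertices; (b) (only $B_n$) a negative or positive edge between $i\ne j$ plus half edges $e^h_i,e^h_j$; (c) (only $C_n$) $e^-_{ij},e^+_{ij},e^\ell_i$. -}

module Defs where

open import Data.Bool using (Bool; true; false; not; if_then_else_)
open import Data.Nat using (ℕ; zero; suc)
open import Data.Fin using (Fin; _<_)
open import Data.Fin.Properties using () renaming (_≟_ to _≟F_)
open import Data.Integer using (ℤ; +_; -_; _*_; _-_) renaming (_+_ to _+ℤ_)
open import Data.List using (List; []; _∷_; map; foldr)
open import Data.List.Relation.Unary.Any using (any?)
open import Data.Product using (_×_; Σ; _,_)
open import Relation.Binary.PropositionalEquality using (_≡_; _≢_; refl)
open import Relation.Nullary using (yes; no; Dec; ¬_)
open import Relation.Nullary.Decidable using (⌊_⌋)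

data Typ : Set where
  B C D : Typ

-- Edges of signed graphs on vertex set [n] = Fin n.
-- neg i j / pos i j require j < i (irrelevant proof), i.e. i > j as in the paper.
data Edge (n : ℕ) : Set where
  neg  : (i j : Fin n) → .(j < i) → Edge n   -- e^-_{ij}, vector e_i - e_j
  pos  : (i j : Fin n) → .(j < i) → Edge n   -- e^+_{ij}, vector e_i + e_j
  half : Fin n → Edge n                      -- e^h_i,   vector e_i
  loop : Fin n → Edge n                      -- e^l_i,   vector 2 e_i

data InK {n : ℕ} : Typ → Edge n → Set where
  inK-neg  : ∀ {Φ i j} .(p : j < i) → InK Φ (neg i j p)
  inK-pos  : ∀ {Φ i j} .(p : j < i) → InK Φ (pos i j p)
  inK-half : ∀ {i} → InK B (half i)
  inK-loop : ∀ {i} → InK C (loop i)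

_≟E_ : ∀ {n} (e f : Edge n) → Dec (e ≡ f)
neg i j _ ≟E neg k l _ with i ≟F k | j ≟F l
... | yes refl | yes refl = yes refl
... | no ¬p | _ = no λ { refl → ¬p refl }
... | yes _ | no ¬q = no λ { refl → ¬q refl }
pos i j _ ≟E pos k l _ with i ≟F k | j ≟F l
... | yes refl | yes refl = yes refl
... | no ¬p | _ = no λ { refl → ¬p refl }
... | yes _ | no ¬q = no λ { refl → ¬q refl }
half i ≟E half k with i ≟F k
... | yes refl = yes refl
... | no ¬p = no λ { refl → ¬p refl }
loop i ≟E loop k with i ≟F k
... | yes refl = yes refl
... | no ¬p = no λ { refl → ¬p refl }
neg _ _ _ ≟E pos _ _ _ = no λ ()
neg _ _ _ ≟E half _ = no λ ()
neg _ _ _ ≟E loop _ = no λ ()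
pos _ _ _ ≟E neg _ _ _ = no λ ()
pos _ _ _ ≟E half _ = no λ ()
pos _ _ _ ≟E loop _ = no λ ()
half _ ≟E neg _ _ _ = no λ ()
half _ ≟E pos _ _ _ = no λ ()
half _ ≟E loop _ = no λ ()
loop _ ≟E neg _ _ _ = no λ ()
loop _ ≟E pos _ _ _ = no λ ()
loop _ ≟E half _ = no λ ()

δ : ∀ {n} → Fin n → Fin n → ℤ
δ i k = if ⌊ i ≟F k ⌋ then + 1 else + 0

vec : ∀ {n} → Edge n → Fin n → ℤ
vec (neg i j _) k = δ i k - δ j k
vec (pos i j _) k = δ i k +ℤ δ j k
vec (half i)    k = δ i k
vec (loop i)    k = + 2 * δ i k

-- A Coxeter tournament: outcome w_e ∈ {0,1} (false = 0, true = 1) for each game.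
-- Only values on edges of K_Φ are meaningful.
Tournament : ℕ → Set
Tournament n = Edge n → Bool

-- 2 (w_e - 1/2) ∈ {-1, +1}
sgn : Bool → ℤ
sgn true  = + 1
sgn false = - (+ 1)

sumℤ : List ℤ → ℤ
sumℤ = foldr _+ℤ_ (+ 0)

-- A sub-tournament (list of games) is neutral:  Σ (w_e - 1/2) e = 0,
-- stated coordinatewise after multiplying by 2.
Neutral : ∀ {n} → Tournament n → List (Edge n) → Set
Neutral {n} T X = (k : Fin n) → sumℤ (map (λ e → sgn (T e) * vec e k) X) ≡ + 0

_✶_ : ∀ {n} → Tournament n → List (Edge n) → Tournament n
(T ✶ X) e = if ⌊ any? (e ≟E_) X ⌋ then not (T e) else T e

data NegJ {n : ℕ} : Edge n → Fin n → Fin n → Set where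
  negJ₁ : ∀ {a b} .(p : b < a) → NegJ (neg a b p) a b
  negJ₂ : ∀ {a b} .(p : a < b) → NegJ (neg b a p) a b

data PosJ {n : ℕ} : Edge n → Fin n → Fin n → Set where
  posJ₁ : ∀ {a b} .(p : b < a) → PosJ (pos a b p) a b
  posJ₂ : ∀ {a b} .(p : a < b) → PosJ (pos b a p) a b

Distinct3 : ∀ {n} → Fin n → Fin n → Fin n → Set
Distinct3 a b c = (a ≢ b) × (a ≢ c) × (b ≢ c)

data GenShape {n : ℕ} : Typ → List (Edge n) → Set where
  triNeg : ∀ {Φ a b c e₁ e₂ e₃} → Distinct3 a b c →
           NegJ e₁ a b → NegJ e₂ a c → NegJ e₃ b c →
           GenShape Φ (e₁ ∷ e₂ ∷ e₃ ∷ [])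
  triMix : ∀ {Φ a b c e₁ e₂ e₃} → Distinct3 a b c →
           NegJ e₁ a b → PosJ e₂ a c → PosJ e₃ b c →
           GenShape Φ (e₁ ∷ e₂ ∷ e₃ ∷ [])
  halfNeg : ∀ {a b e} → a ≢ b → NegJ e a b →
            GenShape B (e ∷ half a ∷ half b ∷ [])
  halfPos : ∀ {a b e} → a ≢ b → PosJ e a b →
            GenShape B (e ∷ half a ∷ half b ∷ [])
  loopC : ∀ {a b e₁ e₂} → a ≢ b → NegJ e₁ a b → PosJ e₂ a b →
          GenShape C (e₁ ∷ e₂ ∷ loop a ∷ [])

GenCopy : ∀ {n} → Typ → Tournament n → List (Edge n) → Set
GenCopy Φ T G = GenShape Φ G × Neutral T G

data Reversals {n : ℕ} (Φ : Typ) : Tournament n → Tournament n → ℕ → Set where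
  done : ∀ {T T'} → (∀ e → T e ≡ T' e) → Reversals Φ T T' zero
  step : ∀ {T T' m} (G : List (Edge n)) → GenCopy Φ T G →
         Reversals Φ (T ✶ G) T' m → Reversals Φ T T' (suc m)

{-# OPTIONS --safe #-}
-- Call h a reducer for two games g₁ ≠ g₂ of I if {g₁, g₂, h} is the game set
-- of a generator and either {g₁, g₂, h} is neutral, or h ∉ I and the signed vector of h is the sum of those
-- of g₁ and g₂. Reversing that generator together with (before or after it) the shorter neutral list
-- "I without g₁, g₂, h" or "I with g₁, g₂ replaced by h" reverses I, and the bound ℓ − 2 is preserved.
--
-- A reducer always exists. Weigh a vertex v by the sum over I of the absolute v-coordinates (by neutrality,
-- half of it is positive), take a heaviest vertex k and an edge g₁ ∈ I from k to x. Each game e ∈ I whose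
-- k-coordinate has the sign opposite to g₁ forms with g₁ a triangle, a type-B or a type-C generator (the last
-- possibly via the other edge between k and x). If none of them gives a reducer, their third games define an
-- injection ψ into I ∖ {g₁} such that ψ e points at x with the sign of g₁ at least as strongly as e points
-- out of k; then x would be heavier than k.
module Submission where

open import Defs
open import Data.Bool as Bool using (Bool; true; false; not; _xor_)
open import Data.Bool.Properties using (not-involutive; not-¬; ¬-not)
open import Data.Empty using (⊥; ⊥-elim)
open import Data.Fin using (Fin) renaming (_<_ to _<ᶠ_)
import Data.Fin.Properties as Fin
open import Data.Fin.Properties using () renaming (_≟_ to _≟ᶠ_; _<?_ to _<ᶠ?_)
open import Data.Integer using (ℤ; +_; -[1+_]; _+_; _-_; _*_; -_)
open import Data.Integer.Properties as ℤ using (neg-distribˡ-*)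
open import Data.Integer.Tactic.RingSolver using (solve-∀)
open import Data.List using (List; []; _∷_; [_]; _++_; map; length; allFin)
open import Data.List.Extrema.Nat using (argmax; f[xs]≤f[argmax])
open import Data.List.Membership.Propositional using (_∈_; _∉_)
open import Data.List.Membership.Propositional.Properties using (∈-∃++; ∈-allFin)
open import Data.List.Relation.Binary.Disjoint.Propositional using (Disjoint)
open import Data.List.Relation.Binary.Permutation.Propositional
  using (_↭_; ↭-refl; ↭-sym; ↭-trans; ↭-prep; ↭-swap; ↭⇒↭ₛ)
open import Data.List.Relation.Binary.Permutation.Propositional.Properties
  using (∈-resp-↭; All-resp-↭; ↭-length; shift; map⁺) renaming (++⁺ʳ to ↭-++⁺ʳ)
import Data.List.Relation.Binary.Permutation.Setoid.Properties as ↭ₛ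
open import Data.List.Relation.Unary.All as All using (All; _∷_)
open import Data.List.Relation.Unary.All.Properties using (All¬⇒¬Any; ¬Any⇒All¬)
open import Data.List.Relation.Unary.AllPairs as AllPairs using (_∷_)
open import Data.List.Relation.Unary.Any using (here; there; any?)
open import Data.List.Relation.Unary.Unique.Propositional using (Unique)
open import Data.List.Relation.Unary.Any.Properties using (++⁺ˡ; ++⁺ʳ; ++⁻)
open import Data.Nat as ℕ using (ℕ; suc; _≤_; _<_; _∸_; s≤s; _≤?_)
open import Data.Nat.Induction using (<-wellFounded)
open import Induction.WellFounded using (Acc; acc)
open import Data.Nat.ListAction using (sum)
open import Data.Nat.ListAction.Properties using (sum-↭)
import Data.Nat.Properties as ℕ
open import Data.Product using (Σ; ∃; ∃₂; _×_; _,_; proj₁; proj₂; uncurry)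
open import Data.Sum as Sum using (_⊎_; inj₁; inj₂; [_,_]′)
open import Function using (_∘_)
open import Relation.Binary.PropositionalEquality
  using (_≡_; _≢_; refl; sym; trans; cong; cong₂; subst; subst₂; _≗_; setoid; module ≡-Reasoning)
open import Relation.Nullary using (Dec; yes; no)
open import Relation.Nullary.Decidable using (recompute)
open import Relation.Binary.Definitions using (tri<; tri≈; tri>)

sgn-not : ∀ b → sgn (not b) ≡ - sgn b
sgn-not true  = refl
sgn-not false = refl

sgn-unit : ∀ s → sgn s ≡ sgn s * + 1
sgn-unit s = sym (ℤ.*-identityʳ (sgn s))

sgn*sgn : ∀ b z → sgn b * (sgn b * z) ≡ z
sgn*sgn true  = solve-∀
sgn*sgn false = solve-∀

_⊙_ : Bool → Bool → Bool
true  ⊙ b = b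
false ⊙ b = not b

sgn-⊙ : ∀ a b → sgn (a ⊙ b) ≡ sgn a * sgn b
sgn-⊙ true  true  = refl
sgn-⊙ true  false = refl
sgn-⊙ false true  = refl
sgn-⊙ false false = refl

⊙-not : ∀ b → b ⊙ not b ≡ false
⊙-not true  = refl
⊙-not false = refl

not-⊙ : ∀ b → not b ⊙ b ≡ false
not-⊙ true  = refl
not-⊙ false = refl

⊙-self : ∀ b → b ⊙ b ≡ true
⊙-self true  = refl
⊙-self false = refl

not-⊙-not : ∀ a b → not a ⊙ not b ≡ a ⊙ b
not-⊙-not true  b = not-involutive b
not-⊙-not false b = refl

not-⊙ˡ : ∀ a b → not a ⊙ b ≡ not (a ⊙ b)
not-⊙ˡ true  b = refl
not-⊙ˡ false b = sym (not-involutive b)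

⊙-cancelˡ : ∀ a {b c} → a ⊙ b ≡ a ⊙ c → b ≡ c
⊙-cancelˡ true  b≡c = b≡c
⊙-cancelˡ false {b} {c} nb≡nc = trans (sym (not-involutive b)) (trans (cong not nb≡nc) (not-involutive c))

⊙-xor : ∀ σ α β → α ⊙ β ≡ (σ ⊙ α) xor (not σ ⊙ β)
⊙-xor true  true  β = sym (not-involutive β)
⊙-xor true  false β = refl
⊙-xor false true  β = refl
⊙-xor false false β = refl

sgn-factor : ∀ c a (z : ℤ) → sgn c * z ≡ sgn (c ⊙ a) * (sgn a * z)
sgn-factor true  true  = solve-∀
sgn-factor true  false = solve-∀
sgn-factor false true  = solve-∀
sgn-factor false false = solve-∀

Unique-resp-↭ : ∀ {A : Set} {xs ys : List A} → xs ↭ ys → Unique xs → Unique ys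
Unique-resp-↭ {A} xs↭ys = ↭ₛ.Unique-resp-↭ (setoid A) (↭⇒↭ₛ xs↭ys)

∈⇒↭∷ : ∀ {A : Set} {x : A} {xs} → x ∈ xs → ∃ λ ys → xs ↭ x ∷ ys
∈⇒↭∷ x∈xs with ys , zs , refl ← ∈-∃++ x∈xs = ys ++ zs , shift _ ys zs

∈⇒↭∷∷ : ∀ {A : Set} {x y : A} {xs} → x ∈ xs → y ∈ xs → x ≢ y → ∃ λ zs → xs ↭ x ∷ y ∷ zs
∈⇒↭∷∷ x∈xs y∈xs x≢y with ys , xs↭x∷ys ← ∈⇒↭∷ x∈xs with ∈-resp-↭ xs↭x∷ys y∈xs
... | here y≡x = ⊥-elim (x≢y (sym y≡x))
... | there y∈ys with zs , ys↭y∷zs ← ∈⇒↭∷ y∈ys = zs , ↭-trans xs↭x∷ys (↭-prep _ ys↭y∷zs)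

first-or-all : ∀ {A R : Set} {P : A → Set} (L : List A) → (∀ {e} → e ∈ L → R ⊎ P e) → R ⊎ (∀ {e} → e ∈ L → P e)
first-or-all []      _      = inj₂ λ ()
first-or-all (e ∷ L) decide with decide (here refl) | first-or-all L (decide ∘ there)
... | inj₁ r  | _       = inj₁ r
... | inj₂ _  | inj₁ r  = inj₁ r
... | inj₂ pe | inj₂ pL = inj₂ λ { (here refl) → pe ; (there e∈L) → pL e∈L }

sum-positive : ∀ {A : Set} (f : A → ℕ) L → 1 ≤ sum (map f L) → ∃ λ e → e ∈ L × 1 ≤ f e
sum-positive f (e ∷ L) 1≤sum with 1 ≤? f e
... | yes 1≤fe = e , here refl , 1≤fe
... | no  fe≱1
  with e′ , e′∈L , 1≤fe′ ← sum-positive f L (subst (λ z → 1 ≤ z ℕ.+ sum (map f L)) (ℕ.n<1⇒n≡0 (ℕ.≰⇒> fe≱1)) 1≤sum)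
  = e′ , there e′∈L , 1≤fe′

sum-≤-by-injection : ∀ {A : Set} (f g : A → ℕ) (ψ : A → A) {L M : List A} → Unique L →
                     (∀ {e} → e ∈ L → 1 ≤ f e → ψ e ∈ M × f e ≤ g (ψ e)) →
                     (∀ {e e′} → e ∈ L → e′ ∈ L → 1 ≤ f e → 1 ≤ f e′ → ψ e ≡ ψ e′ → e ≡ e′) →
                     sum (map f L) ≤ sum (map g M)
sum-≤-by-injection f g ψ {[]}    _ _ _ = ℕ.z≤n
sum-≤-by-injection f g ψ {e ∷ L} {M} (e∉L ∷ unique) image injective with 1 ≤? f e
... | no fe≱1 = subst (λ z → z ℕ.+ sum (map f L) ≤ _) (sym (ℕ.n<1⇒n≡0 (ℕ.≰⇒> fe≱1)))
                      (sum-≤-by-injection f g ψ unique (image ∘ there) (λ p q → injective (there p) (there q)))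
... | yes 1≤fe with ψe∈M , fe≤ ← image (here refl) 1≤fe with M′ , M↭ ← ∈⇒↭∷ ψe∈M = begin
  f e ℕ.+ sum (map f L)       ≤⟨ ℕ.+-mono-≤ fe≤ (sum-≤-by-injection f g ψ unique image′ (λ p q → injective (there p) (there q)))
                               ⟩
  g (ψ e) ℕ.+ sum (map g M′)  ≡⟨ sum-↭ (map⁺ g M↭) ⟨
  sum (map g M)               ∎
  where
  open ℕ.≤-Reasoning
  image′ : ∀ {e′} → e′ ∈ L → 1 ≤ f e′ → ψ e′ ∈ M′ × f e′ ≤ g (ψ e′)
  image′ e′∈L 1≤fe′ with ψe′∈M , fe′≤ ← image (there e′∈L) 1≤fe′ with ∈-resp-↭ M↭ ψe′∈M
  ... | here ψe′≡ψe  = ⊥-elim (All¬⇒¬Any e∉L (subst (_∈ L) (injective (there e′∈L) (here refl) 1≤fe′ 1≤fe ψe′≡ψe)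
                                                         e′∈L))
  ... | there ψe′∈M′ = ψe′∈M′ , fe′≤

module _ {n : ℕ} where

  ✶-∈ : ∀ (T : Tournament n) {X e} → e ∈ X → (T ✶ X) e ≡ not (T e)
  ✶-∈ T {X} {e} e∈X with any? (e ≟E_) X
  ... | yes _    = refl
  ... | no  e∉X = ⊥-elim (e∉X e∈X)

  ✶-∉ : ∀ (T : Tournament n) {X e} → e ∉ X → (T ✶ X) e ≡ T e
  ✶-∉ T {X} {e} e∉X with any? (e ≟E_) X
  ... | yes e∈X = ⊥-elim (e∉X e∈X)
  ... | no  _    = refl

  ✶-cong : ∀ {T S : Tournament n} X → T ≗ S → T ✶ X ≗ S ✶ X
  ✶-cong X T≗S e with any? (e ≟E_) X
  ... | yes _ = cong not (T≗S e)
  ... | no  _ = T≗S e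

  ✶-involutive : ∀ (T : Tournament n) X → (T ✶ X) ✶ X ≗ T
  ✶-involutive T X e with any? (e ≟E_) X
  ... | yes _ = not-involutive (T e)
  ... | no  _ = refl

  ✶-comm : ∀ (T : Tournament n) X Y → (T ✶ X) ✶ Y ≗ (T ✶ Y) ✶ X
  ✶-comm T X Y e with any? (e ≟E_) X | any? (e ≟E_) Y
  ... | yes _ | yes _ = refl
  ... | yes _ | no  _ = refl
  ... | no  _ | yes _ = refl
  ... | no  _ | no  _ = refl

  ✶-resp-↭ : ∀ (T : Tournament n) {X Y} → X ↭ Y → T ✶ X ≗ T ✶ Y
  ✶-resp-↭ T {X} X↭Y e with any? (e ≟E_) X
  ... | yes e∈X = sym (✶-∈ T (∈-resp-↭ X↭Y e∈X))
  ... | no  e∉X = sym (✶-∉ T (e∉X ∘ ∈-resp-↭ (↭-sym X↭Y)))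

  ✶-++ : ∀ (T : Tournament n) X Y → Disjoint X Y → (T ✶ X) ✶ Y ≗ T ✶ (X ++ Y)
  ✶-++ T X Y X#Y e with any? (e ≟E_) X | any? (e ≟E_) Y
  ... | yes e∈X | yes e∈Y = ⊥-elim (X#Y (e∈X , e∈Y))
  ... | yes e∈X | no  _   = sym (✶-∈ T (++⁺ˡ e∈X))
  ... | no  _   | yes e∈Y = sym (✶-∈ T (++⁺ʳ X e∈Y))
  ... | no  e∉X | no  e∉Y = sym (✶-∉ T ([ e∉X , e∉Y ]′ ∘ ++⁻ X))

  ✶-exchange : ∀ (T : Tournament n) {G} g₁ g₂ h R → G ↭ g₁ ∷ g₂ ∷ h ∷ [] →
               h ∉ g₁ ∷ g₂ ∷ R → Disjoint (g₁ ∷ g₂ ∷ []) R →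
               (T ✶ G) ✶ (h ∷ R) ≗ T ✶ (g₁ ∷ g₂ ∷ R)
  ✶-exchange T {G} g₁ g₂ h R G↭ h∉ P#R e = begin
    ((T ✶ G) ✶ (h ∷ R)) e                  ≡⟨ ✶-cong (h ∷ R) (✶-resp-↭ T G↭) e ⟩
    ((T ✶ (P ++ [ h ])) ✶ ([ h ] ++ R)) e  ≡⟨ ✶-cong (h ∷ R) (sym ∘ ✶-++ T P [ h ] P#h) e ⟩
    (((T ✶ P) ✶ [ h ]) ✶ ([ h ] ++ R)) e   ≡⟨ ✶-++ ((T ✶ P) ✶ [ h ]) [ h ] R h#R e ⟨
    ((((T ✶ P) ✶ [ h ]) ✶ [ h ]) ✶ R) e    ≡⟨ ✶-cong R (✶-involutive (T ✶ P) [ h ]) e ⟩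
    ((T ✶ P) ✶ R) e                        ≡⟨ ✶-++ T P R P#R e ⟩
    (T ✶ (P ++ R)) e                       ∎
    where
    open ≡-Reasoning
    P = g₁ ∷ g₂ ∷ []
    P#h : Disjoint P [ h ]
    P#h (h∈P , here refl) = h∉ (++⁺ˡ h∈P)
    h#R : Disjoint [ h ] R
    h#R (here refl , h∈R) = h∉ (++⁺ʳ P h∈R)

  svec : Tournament n → Edge n → Fin n → ℤ
  svec T e v = sgn (T e) * vec e v

  Σsvec : Tournament n → List (Edge n) → Fin n → ℤ
  Σsvec T X v = sumℤ (map (λ e → svec T e v) X)

  svec-✶-∈ : ∀ (T : Tournament n) {X e} → e ∈ X → ∀ v → svec (T ✶ X) e v ≡ - svec T e v
  svec-✶-∈ T {X} {e} e∈X v = begin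
    sgn ((T ✶ X) e) * vec e v  ≡⟨ cong (λ b → sgn b * vec e v) (✶-∈ T e∈X) ⟩
    sgn (not (T e)) * vec e v  ≡⟨ cong (_* vec e v) (sgn-not (T e)) ⟩
    - sgn (T e) * vec e v      ≡⟨ neg-distribˡ-* (sgn (T e)) (vec e v) ⟨
    - svec T e v               ∎
    where open ≡-Reasoning

  svec-✶-∉ : ∀ (T : Tournament n) {X e} → e ∉ X → ∀ v → svec (T ✶ X) e v ≡ svec T e v
  svec-✶-∉ T {e = e} e∉X v = cong (λ b → sgn b * vec e v) (✶-∉ T e∉X)

  Σsvec-✶-disjoint : ∀ (T : Tournament n) {X} Y → Disjoint X Y → ∀ v → Σsvec (T ✶ X) Y v ≡ Σsvec T Y v
  Σsvec-✶-disjoint T []      X#Y v = refl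
  Σsvec-✶-disjoint T (e ∷ Y) X#Y v =
    cong₂ _+_ (svec-✶-∉ T (λ e∈X → X#Y (e∈X , here refl)) v)
              (Σsvec-✶-disjoint T Y (λ (p , q) → X#Y (p , there q)) v)

  Σsvec-resp-↭ : ∀ (T : Tournament n) {X Y} → X ↭ Y → ∀ v → Σsvec T X v ≡ Σsvec T Y v
  Σsvec-resp-↭ T X↭Y v =
    ↭ₛ.foldr-commMonoid (setoid ℤ) ℤ.+-0-isCommutativeMonoid (↭⇒↭ₛ (map⁺ (λ e → svec T e v) X↭Y))

  Neutral-resp-↭ : ∀ (T : Tournament n) {X Y} → X ↭ Y → Neutral T X → Neutral T Y
  Neutral-resp-↭ T X↭Y neutral v = trans (sym (Σsvec-resp-↭ T X↭Y v)) (neutral v)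

  Neutral-resp-≗ : ∀ {T S : Tournament n} X → T ≗ S → Neutral T X → Neutral S X
  Neutral-resp-≗ {T} {S} X T≗S neutral v = trans (sym (Σsvec-cong X)) (neutral v)
    where
    Σsvec-cong : ∀ Y → Σsvec T Y v ≡ Σsvec S Y v
    Σsvec-cong []      = refl
    Σsvec-cong (e ∷ Y) = cong₂ _+_ (cong (λ b → sgn b * vec e v) (T≗S e)) (Σsvec-cong Y)

module _ {n : ℕ} {Φ : Typ} where

  Reversals-respʳ-≗ : ∀ {T T₁ T₂ : Tournament n} {m} → T₁ ≗ T₂ → Reversals Φ T T₁ m → Reversals Φ T T₂ m
  Reversals-respʳ-≗ T₁≗T₂ (done T≗T₁)    = done (λ e → trans (T≗T₁ e) (T₁≗T₂ e))
  Reversals-respʳ-≗ T₁≗T₂ (step G copy r) = step G copy (Reversals-respʳ-≗ T₁≗T₂ r)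

  Reversals-respˡ-≗ : ∀ {S T T₁ : Tournament n} {m} → S ≗ T → Reversals Φ T T₁ m → Reversals Φ S T₁ m
  Reversals-respˡ-≗ S≗T (done T≗T₁) = done (λ e → trans (S≗T e) (T≗T₁ e))
  Reversals-respˡ-≗ S≗T (step G (shape , neutral) r) =
    step G (shape , Neutral-resp-≗ G (sym ∘ S≗T) neutral) (Reversals-respˡ-≗ (✶-cong G S≗T) r)

  Reversals-trans : ∀ {T T₁ T₂ : Tournament n} {m₁ m₂} →
                    Reversals Φ T T₁ m₁ → Reversals Φ T₁ T₂ m₂ → Reversals Φ T T₂ (m₁ ℕ.+ m₂)
  Reversals-trans (done T≗T₁)    r₂ = Reversals-respˡ-≗ T≗T₁ r₂
  Reversals-trans (step G copy r) r₂ = step G copy (Reversals-trans r r₂)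

  reversal : ∀ {T : Tournament n} {G} → GenCopy Φ T G → Reversals Φ T (T ✶ G) 1
  reversal copy = step _ copy (done λ _ → refl)

module _ {n : ℕ} where

  Completes Replaces : Tournament n → Edge n → Edge n → Edge n → Set
  Completes T h g₁ g₂ = ∀ v → svec T h v ≡ - (svec T g₁ v + svec T g₂ v)
  Replaces  T h g₁ g₂ = ∀ v → svec T h v ≡ svec T g₁ v + svec T g₂ v

  Completes⇒Neutral : ∀ (T : Tournament n) {h g₁ g₂} → Completes T h g₁ g₂ → Neutral T (g₁ ∷ g₂ ∷ h ∷ [])
  Completes⇒Neutral T {h} {g₁} {g₂} completes v =
    trans (cong (λ z → svec T g₁ v + (svec T g₂ v + (z + + 0))) (completes v)) (cancel (svec T g₁ v) (svec T g₂ v))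
    where
    cancel : ∀ x y → x + (y + (- (x + y) + + 0)) ≡ + 0
    cancel = solve-∀

  record Generator (Φ : Typ) (g₁ g₂ h : Edge n) : Set where
    field
      games  : List (Edge n)
      shape  : GenShape Φ games
      games↭ : games ↭ g₁ ∷ g₂ ∷ h ∷ []

  record Reducer (Φ : Typ) (T : Tournament n) (L : List (Edge n)) : Set where
    field
      g₁ g₂ h   : Edge n
      g₁∈L      : g₁ ∈ L
      g₂∈L      : g₂ ∈ L
      g₁≢g₂     : g₁ ≢ g₂
      h≢g₁      : h ≢ g₁
      h≢g₂      : h ≢ g₂
      h∈K       : InK Φ h
      generator : Generator Φ g₁ g₂ h
      closing   : Completes T h g₁ g₂ ⊎ (h ∉ L × Replaces T h g₁ g₂)

  -- The bound m ≤ length L ∸ 2 in a form that survives the induction (∸ truncates for short lists).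
  Reversible : Typ → Tournament n → List (Edge n) → Set
  Reversible Φ T L = ∃ λ m → Reversals Φ T (T ✶ L) m × ((length L ≡ 0 × m ≡ 0) ⊎ 2 ℕ.+ m ≤ length L)

  ReversibleBelow : Typ → ℕ → Set
  ReversibleBelow Φ l = ∀ (T : Tournament n) L → length L < l →
                        Unique L → All (InK Φ) L → Neutral T L → Reversible Φ T L

  Reversible-resp-↭ : ∀ {Φ} {T : Tournament n} {L L′} → L ↭ L′ → Reversible Φ T L → Reversible Φ T L′
  Reversible-resp-↭ {T = T} L↭L′ (m , r , bound) =
    m , Reversals-respʳ-≗ (✶-resp-↭ T L↭L′) r , subst (λ l → (l ≡ 0 × m ≡ 0) ⊎ 2 ℕ.+ m ≤ l) (↭-length L↭L′) bound

module Reduction {n : ℕ} {Φ : Typ} (T : Tournament n) (g₁ g₂ h : Edge n) (R : List (Edge n))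
  (unique : Unique (g₁ ∷ g₂ ∷ R)) (inK : All (InK Φ) (g₁ ∷ g₂ ∷ R)) (neutral : Neutral T (g₁ ∷ g₂ ∷ R))
  (h∈K : InK Φ h) (generator : Generator Φ g₁ g₂ h) (IH : ReversibleBelow {n} Φ (length (g₁ ∷ g₂ ∷ R)))
  where

  open Generator generator

  g₁∉R : g₁ ∉ R
  g₁∉R = All¬⇒¬Any (All.tail (AllPairs.head unique))

  g₂∉R : g₂ ∉ R
  g₂∉R = All¬⇒¬Any (AllPairs.head (AllPairs.tail unique))

  uniqueR : Unique R
  uniqueR = AllPairs.tail (AllPairs.tail unique)

  inKR : All (InK Φ) R
  inKR = All.tail (All.tail inK)

  h∈games : h ∈ games
  h∈games = ∈-resp-↭ (↭-sym games↭) (there (there (here refl)))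

  games# : ∀ {X} → g₁ ∉ X → g₂ ∉ X → h ∉ X → Disjoint games X
  games# g₁∉X g₂∉X h∉X (e∈games , e∈X) with ∈-resp-↭ games↭ e∈games
  ... | here refl                 = g₁∉X e∈X
  ... | there (here refl)         = g₂∉X e∈X
  ... | there (there (here refl)) = h∉X e∈X

  P#R : Disjoint (g₁ ∷ g₂ ∷ []) R
  P#R (here refl , g₁∈R)         = g₁∉R g₁∈R
  P#R (there (here refl) , g₂∈R) = g₂∉R g₂∈R

  games-copy : ∀ S → Completes S h g₁ g₂ → GenCopy Φ S games
  games-copy S completes = shape , Neutral-resp-↭ S (↭-sym games↭) (Completes⇒Neutral S completes)

  substitute-first : Completes T h g₁ g₂ → h ∉ g₁ ∷ g₂ ∷ R → Reversible Φ T (g₁ ∷ g₂ ∷ R)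
  substitute-first completes h∉ with IH (T ✶ games) (h ∷ R) (ℕ.n<1+n _) (¬Any⇒All¬ R h∉R ∷ uniqueR) (h∈K ∷ inKR) neutral′
    where
    h∉R : h ∉ R
    h∉R = h∉ ∘ there ∘ there
    neutral′ : Neutral (T ✶ games) (h ∷ R)
    neutral′ v = begin
      svec (T ✶ games) h v + Σsvec (T ✶ games) R v
        ≡⟨ cong₂ _+_ (svec-✶-∈ T h∈games v) (Σsvec-✶-disjoint T R (games# g₁∉R g₂∉R h∉R) v) ⟩
      - svec T h v + Σsvec T R v
        ≡⟨ cong (λ z → - z + Σsvec T R v) (completes v) ⟩
      - - (svec T g₁ v + svec T g₂ v) + Σsvec T R v
        ≡⟨ regroup (svec T g₁ v) (svec T g₂ v) (Σsvec T R v) ⟩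
      svec T g₁ v + (svec T g₂ v + Σsvec T R v)
        ≡⟨ neutral v ⟩
      + 0 ∎
      where
      open ≡-Reasoning
      regroup : ∀ x y r → - - (x + y) + r ≡ x + (y + r)
      regroup = solve-∀
  ... | _ , _ , inj₁ (() , _)
  ... | m , r , inj₂ bound =
    suc m , step games (games-copy T completes) (Reversals-respʳ-≗ (✶-exchange T g₁ g₂ h R games↭ h∉ P#R) r) , inj₂ (s≤s bound)

  substitute-last : Replaces T h g₁ g₂ → h ∉ g₁ ∷ g₂ ∷ R → Reversible Φ T (g₁ ∷ g₂ ∷ R)
  substitute-last replaces h∉ with IH T (h ∷ R) (ℕ.n<1+n _) (¬Any⇒All¬ R (h∉ ∘ there ∘ there) ∷ uniqueR) (h∈K ∷ inKR) neutral′
    where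
    neutral′ : Neutral T (h ∷ R)
    neutral′ v = trans (cong (_+ Σsvec T R v) (replaces v)) (trans (ℤ.+-assoc (svec T g₁ v) (svec T g₂ v) (Σsvec T R v)) (neutral v))
  ... | _ , _ , inj₁ (() , _)
  ... | m , r , inj₂ bound =
    m ℕ.+ 1 , Reversals-respʳ-≗ flips (Reversals-trans r (reversal (games-copy T₁ completes)))
            , inj₂ (subst (λ k → 2 ℕ.+ k ≤ length (g₁ ∷ g₂ ∷ R)) (ℕ.+-comm 1 m) (s≤s bound))
    where
    T₁ = T ✶ (h ∷ R)
    g∉ : ∀ {g} → h ≢ g → g ∉ R → g ∉ h ∷ R
    g∉ h≢g g∉R (here g≡h) = h≢g (sym g≡h)
    g∉ h≢g g∉R (there g∈R) = g∉R g∈R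
    completes : Completes T₁ h g₁ g₂
    completes v = begin
      svec T₁ h v                          ≡⟨ svec-✶-∈ T (here refl) v ⟩
      - svec T h v                         ≡⟨ cong -_ (replaces v) ⟩
      - (svec T g₁ v + svec T g₂ v)        ≡⟨ cong₂ (λ x y → - (x + y)) (svec-✶-∉ T (g∉ (h∉ ∘ here) g₁∉R) v)
                                                                       (svec-✶-∉ T (g∉ (h∉ ∘ there ∘ here) g₂∉R) v) ⟨
      - (svec T₁ g₁ v + svec T₁ g₂ v)      ∎
      where open ≡-Reasoning
    flips : (T₁ ✶ games) ≗ T ✶ (g₁ ∷ g₂ ∷ R)
    flips e = trans (✶-comm T (h ∷ R) games e) (✶-exchange T g₁ g₂ h R games↭ h∉ P#R e)

  module _ {R′} (R↭ : R ↭ h ∷ R′) where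

    private
      unique′ : Unique (h ∷ R′)
      unique′ = Unique-resp-↭ R↭ uniqueR

      R′⊆R : ∀ {e} → e ∈ R′ → e ∈ R
      R′⊆R = ∈-resp-↭ (↭-sym R↭) ∘ there

      games#R′ : Disjoint games R′
      games#R′ = games# (g₁∉R ∘ R′⊆R) (g₂∉R ∘ R′⊆R) (All¬⇒¬Any (AllPairs.head unique′))

      shorter : length R′ < length (g₁ ∷ g₂ ∷ R)
      shorter = subst (λ l → length R′ < 2 ℕ.+ l) (sym (↭-length R↭)) (ℕ.m≤n+m _ 2)

    split : Completes T h g₁ g₂ → Reversible Φ T (g₁ ∷ g₂ ∷ R)
    split completes with IH (T ✶ games) R′ shorter (AllPairs.tail unique′) (All.tail (All-resp-↭ R↭ inKR)) neutral′
      where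
      neutral′ : Neutral (T ✶ games) R′
      neutral′ v = begin
        Σsvec (T ✶ games) R′ v
          ≡⟨ Σsvec-✶-disjoint T R′ games#R′ v ⟩
        Σsvec T R′ v
          ≡⟨ regroup (svec T g₁ v) (svec T g₂ v) (Σsvec T R′ v) ⟩
        svec T g₁ v + (svec T g₂ v + (- (svec T g₁ v + svec T g₂ v) + Σsvec T R′ v))
          ≡⟨ cong (λ z → svec T g₁ v + (svec T g₂ v + (z + Σsvec T R′ v))) (completes v) ⟨
        svec T g₁ v + (svec T g₂ v + Σsvec T (h ∷ R′) v)
          ≡⟨ cong (λ z → svec T g₁ v + (svec T g₂ v + z)) (Σsvec-resp-↭ T R↭ v) ⟨
        svec T g₁ v + (svec T g₂ v + Σsvec T R v)
          ≡⟨ neutral v ⟩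
        + 0 ∎
        where
        open ≡-Reasoning
        regroup : ∀ x y r → r ≡ x + (y + (- (x + y) + r))
        regroup = solve-∀
    ... | m , r , bound = suc m , step games (games-copy T completes) (Reversals-respʳ-≗ flips r) , inj₂ bound′
      where
      flips : (T ✶ games) ✶ R′ ≗ T ✶ (g₁ ∷ g₂ ∷ R)
      flips e = trans (✶-++ T games R′ games#R′ e)
                      (✶-resp-↭ T (↭-trans (↭-++⁺ʳ R′ games↭) (↭-sym (↭-prep g₁ (↭-prep g₂ R↭)))) e)
      m≤R′ : m ≤ length R′
      m≤R′ = [ (λ (_ , m≡0) → subst (_≤ length R′) (sym m≡0) ℕ.z≤n) , ℕ.≤-trans (ℕ.m≤n+m m 2) ]′ bound
      bound′ : 2 ℕ.+ suc m ≤ length (g₁ ∷ g₂ ∷ R)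
      bound′ = subst (λ l → 2 ℕ.+ suc m ≤ 2 ℕ.+ l) (sym (↭-length R↭)) (s≤s (s≤s (s≤s m≤R′)))

reduce : ∀ {n Φ} {T : Tournament n} {L} → Unique L → All (InK Φ) L → Neutral T L →
         ReversibleBelow {n} Φ (length L) → Reducer Φ T L → Reversible Φ T L
reduce {T = T} {L} unique inK neutral IH reducer = Reversible-resp-↭ (↭-sym L↭) reversible
  where
  open Reducer reducer
  R = proj₁ (∈⇒↭∷∷ g₁∈L g₂∈L g₁≢g₂)
  L↭ = proj₂ (∈⇒↭∷∷ g₁∈L g₂∈L g₁≢g₂)
  IH′ : ReversibleBelow _ (length (g₁ ∷ g₂ ∷ R))
  IH′ T′ L′ shorter = IH T′ L′ (subst (length L′ <_) (sym (↭-length L↭)) shorter)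
  open Reduction T g₁ g₂ h R (Unique-resp-↭ L↭ unique) (All-resp-↭ L↭ inK) (Neutral-resp-↭ T L↭ neutral)
                 h∈K generator IH′
  reversible : Reversible _ T (g₁ ∷ g₂ ∷ R)
  reversible with closing
  ... | inj₂ (h∉L , replaces) = substitute-last replaces (h∉L ∘ ∈-resp-↭ (↭-sym L↭))
  ... | inj₁ completes with any? (h ≟E_) R
  ...   | yes h∈R = split (proj₂ (∈⇒↭∷ h∈R)) completes
  ...   | no  h∉R = substitute-first completes λ
          { (here h≡g₁)         → h≢g₁ h≡g₁
          ; (there (here h≡g₂)) → h≢g₂ h≡g₂
          ; (there (there h∈R)) → h∉R h∈R
          }

half-injective : ∀ {n} {a b : Fin n} → half a ≡ half b → a ≡ b
half-injective refl = refl

InK-half : ∀ {n Φ} {a : Fin n} → InK Φ (half a) → Φ ≡ B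
InK-half inK-half = refl

InK-loop : ∀ {n Φ} {a : Fin n} → InK Φ (loop a) → Φ ≡ C
InK-loop inK-loop = refl

half≢loop : ∀ {n Φ} {a b : Fin n} → InK Φ (half a) → InK Φ (loop b) → ⊥
half≢loop inK-half ()

module _ {n : ℕ} where

  data Joins : Bool → Edge n → Fin n → Fin n → Set where
    negative : ∀ {e a b} → NegJ e a b → Joins false e a b
    positive : ∀ {e a b} → PosJ e a b → Joins true e a b

  joins-sym : ∀ {t e a b} → Joins t e a b → Joins t e b a
  joins-sym (negative (negJ₁ p)) = negative (negJ₂ p)
  joins-sym (negative (negJ₂ p)) = negative (negJ₁ p)
  joins-sym (positive (posJ₁ p)) = positive (posJ₂ p)
  joins-sym (positive (posJ₂ p)) = positive (posJ₁ p)

  private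
    <-irrefl′ : ∀ {a : Fin n} → .(a <ᶠ a) → ⊥
    <-irrefl′ {a} a<a = Fin.<-irrefl refl (recompute (a <ᶠ? a) a<a)

    <-asym′ : ∀ {a b : Fin n} → .(a <ᶠ b) → .(b <ᶠ a) → ⊥
    <-asym′ {a} {b} a<b b<a = Fin.<-asym (recompute (a <ᶠ? b) a<b) (recompute (b <ᶠ? a) b<a)

  joins-≢ : ∀ {t e a b} → Joins t e a b → a ≢ b
  joins-≢ (negative (negJ₁ p)) refl = <-irrefl′ p
  joins-≢ (negative (negJ₂ p)) refl = <-irrefl′ p
  joins-≢ (positive (posJ₁ p)) refl = <-irrefl′ p
  joins-≢ (positive (posJ₂ p)) refl = <-irrefl′ p

  joins-unique : ∀ {t e e′ a b} → Joins t e a b → Joins t e′ a b → e ≡ e′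
  joins-unique (negative (negJ₁ p)) (negative (negJ₁ q)) = refl
  joins-unique (negative (negJ₁ p)) (negative (negJ₂ q)) = ⊥-elim (<-asym′ p q)
  joins-unique (negative (negJ₂ p)) (negative (negJ₁ q)) = ⊥-elim (<-asym′ p q)
  joins-unique (negative (negJ₂ p)) (negative (negJ₂ q)) = refl
  joins-unique (positive (posJ₁ p)) (positive (posJ₁ q)) = refl
  joins-unique (positive (posJ₁ p)) (positive (posJ₂ q)) = ⊥-elim (<-asym′ p q)
  joins-unique (positive (posJ₂ p)) (positive (posJ₁ q)) = ⊥-elim (<-asym′ p q)
  joins-unique (positive (posJ₂ p)) (positive (posJ₂ q)) = refl

  SameEnds : Fin n → Fin n → Fin n → Fin n → Set
  SameEnds a b c d = (a ≡ c × b ≡ d) ⊎ (a ≡ d × b ≡ c)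

  joins-ends : ∀ {t t′ e a b c d} → Joins t e a b → Joins t′ e c d → t ≡ t′ × SameEnds a b c d
  joins-ends (negative (negJ₁ p)) (negative (negJ₁ q)) = refl , inj₁ (refl , refl)
  joins-ends (negative (negJ₁ p)) (negative (negJ₂ q)) = refl , inj₂ (refl , refl)
  joins-ends (negative (negJ₂ p)) (negative (negJ₁ q)) = refl , inj₂ (refl , refl)
  joins-ends (negative (negJ₂ p)) (negative (negJ₂ q)) = refl , inj₁ (refl , refl)
  joins-ends (positive (posJ₁ p)) (positive (posJ₁ q)) = refl , inj₁ (refl , refl)
  joins-ends (positive (posJ₁ p)) (positive (posJ₂ q)) = refl , inj₂ (refl , refl)
  joins-ends (positive (posJ₂ p)) (positive (posJ₁ q)) = refl , inj₂ (refl , refl)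
  joins-ends (positive (posJ₂ p)) (positive (posJ₂ q)) = refl , inj₁ (refl , refl)

  joins-≢-half : ∀ {t e a b c} → Joins t e a b → e ≢ half c
  joins-≢-half (negative (negJ₁ _)) ()
  joins-≢-half (negative (negJ₂ _)) ()
  joins-≢-half (positive (posJ₁ _)) ()
  joins-≢-half (positive (posJ₂ _)) ()

  joins-≢-loop : ∀ {t e a b c} → Joins t e a b → e ≢ loop c
  joins-≢-loop (negative (negJ₁ _)) ()
  joins-≢-loop (negative (negJ₂ _)) ()
  joins-≢-loop (positive (posJ₁ _)) ()
  joins-≢-loop (positive (posJ₂ _)) ()

  joins-InK : ∀ {Φ t e a b} → Joins t e a b → InK Φ e
  joins-InK (negative (negJ₁ p)) = inK-neg p
  joins-InK (negative (negJ₂ p)) = inK-neg p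
  joins-InK (positive (posJ₁ p)) = inK-pos p
  joins-InK (positive (posJ₂ p)) = inK-pos p

  edgeBetween : Bool → (a b : Fin n) → a ≢ b → Edge n
  edgeBetween t a b a≢b with Fin.<-cmp b a | t
  ... | tri< b<a _ _ | false = neg a b b<a
  ... | tri< b<a _ _ | true  = pos a b b<a
  ... | tri≈ _ b≡a _ | _     = ⊥-elim (a≢b (sym b≡a))
  ... | tri> _ _ a<b | false = neg b a a<b
  ... | tri> _ _ a<b | true  = pos b a a<b

  edgeBetween-joins : ∀ t (a b : Fin n) (a≢b : a ≢ b) → Joins t (edgeBetween t a b a≢b) a b
  edgeBetween-joins t a b a≢b with Fin.<-cmp b a | t
  ... | tri< b<a _ _ | false = negative (negJ₁ b<a)
  ... | tri< b<a _ _ | true  = positive (posJ₁ b<a)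
  ... | tri≈ _ b≡a _ | _     = ⊥-elim (a≢b (sym b≡a))
  ... | tri> _ _ a<b | false = negative (negJ₂ a<b)
  ... | tri> _ _ a<b | true  = positive (posJ₂ a<b)

  δ-same : ∀ (a : Fin n) → δ a a ≡ + 1
  δ-same a with a ≟ᶠ a
  ... | yes _   = refl
  ... | no  a≢a = ⊥-elim (a≢a refl)

  δ-≢ : ∀ {a b : Fin n} → a ≢ b → δ a b ≡ + 0
  δ-≢ {a} {b} a≢b with a ≟ᶠ b
  ... | yes a≡b = ⊥-elim (a≢b a≡b)
  ... | no  _   = refl

  signedPair : Fin n → Bool → Fin n → Bool → Fin n → ℤ
  signedPair a s b t v = sgn s * δ a v + sgn t * δ b v

  signedPair-at-first : ∀ {a b : Fin n} s t → a ≢ b → signedPair a s b t a ≡ sgn s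
  signedPair-at-first {a} {b} s t a≢b =
    trans (cong₂ (λ p q → sgn s * p + sgn t * q) (δ-same a) (δ-≢ (a≢b ∘ sym))) (eval (sgn s) (sgn t))
    where
    eval : ∀ x y → x * + 1 + y * + 0 ≡ x
    eval = solve-∀

  signedPair-at-second : ∀ {a b : Fin n} s t → a ≢ b → signedPair a s b t b ≡ sgn t
  signedPair-at-second {a} {b} s t a≢b =
    trans (cong₂ (λ p q → sgn s * p + sgn t * q) (δ-≢ a≢b) (δ-same b)) (eval (sgn s) (sgn t))
    where
    eval : ∀ x y → x * + 0 + y * + 1 ≡ y
    eval = solve-∀

  joins-vec : ∀ {s t e a b} → Joins (s ⊙ t) e a b → ∃ λ ε → ∀ v → vec e v ≡ sgn ε * signedPair a s b t v
  joins-vec {s} {t} {a = a} {b} j =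
    proj₁ (unsigned j) ⊙ s , λ v → trans (proj₂ (unsigned j) v) (rescale (proj₁ (unsigned j)) s t (δ a v) (δ b v))
    where
    unsigned : ∀ {u e a b} → Joins u e a b → ∃ λ ε → ∀ v → vec e v ≡ sgn ε * (δ a v + sgn u * δ b v)
    unsigned {a = a} {b} (negative (negJ₁ _)) = true  , λ v → eval (δ a v) (δ b v)
      where
      eval : ∀ x y → x - y ≡ + 1 * (x + - (+ 1) * y)
      eval = solve-∀
    unsigned {a = a} {b} (negative (negJ₂ _)) = false , λ v → eval (δ a v) (δ b v)
      where
      eval : ∀ x y → y - x ≡ - (+ 1) * (x + - (+ 1) * y)
      eval = solve-∀
    unsigned {a = a} {b} (positive (posJ₁ _)) = true  , λ v → eval (δ a v) (δ b v)
      where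
      eval : ∀ x y → x + y ≡ + 1 * (x + + 1 * y)
      eval = solve-∀
    unsigned {a = a} {b} (positive (posJ₂ _)) = true  , λ v → eval (δ a v) (δ b v)
      where
      eval : ∀ x y → y + x ≡ + 1 * (x + + 1 * y)
      eval = solve-∀
    rescale : ∀ ε s t (x y : ℤ) → sgn ε * (x + sgn (s ⊙ t) * y) ≡ sgn (ε ⊙ s) * (sgn s * x + sgn t * y)
    rescale true  true  true  = solve-∀
    rescale true  true  false = solve-∀
    rescale true  false true  = solve-∀
    rescale true  false false = solve-∀
    rescale false true  true  = solve-∀
    rescale false true  false = solve-∀
    rescale false false true  = solve-∀
    rescale false false false = solve-∀

  svec-joins : ∀ (T : Tournament n) {s t e a b} → Joins (s ⊙ t) e a b →
               ∃ λ ε → ∀ v → svec T e v ≡ sgn ε * signedPair a s b t v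
  svec-joins T {s} {t} {e} {a} {b} j = T e ⊙ ε , λ v → begin
    sgn (T e) * vec e v                            ≡⟨ cong (sgn (T e) *_) (vec-e v) ⟩
    sgn (T e) * (sgn ε * signedPair a s b t v)     ≡⟨ ℤ.*-assoc (sgn (T e)) (sgn ε) _ ⟨
    sgn (T e) * sgn ε * signedPair a s b t v       ≡⟨ cong (_* signedPair a s b t v) (sgn-⊙ (T e) ε) ⟨
    sgn (T e ⊙ ε) * signedPair a s b t v           ∎
    where
    open ≡-Reasoning
    ε = proj₁ (joins-vec {s} {t} j)
    vec-e = proj₂ (joins-vec {s} {t} j)

  data Incidence (T : Tournament n) (k : Fin n) : Edge n → Set where
    at-edge : ∀ {e} y s t → Joins (s ⊙ t) e k y → (∀ v → svec T e v ≡ signedPair k s y t v) → Incidence T k e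
    at-half : Incidence T k (half k)
    at-loop : Incidence T k (loop k)
    away    : ∀ {e} → vec e k ≡ + 0 → Incidence T k e

  incidence : ∀ (T : Tournament n) k e → Incidence T k e
  incidence T k (neg i j p) with k ≟ᶠ i | k ≟ᶠ j
  ... | yes refl | _ = at-edge j w (not w) (subst (λ t → Joins t _ k j) (sym (⊙-not w)) (negative (negJ₁ p)))
                         λ v → trans (eval (sgn w) (δ k v) (δ j v)) (cong (λ z → sgn w * δ k v + z * δ j v) (sym (sgn-not w)))
    where
    w = T (neg k j p)
    eval : ∀ w x y → w * (x - y) ≡ w * x + - w * y
    eval = solve-∀
  ... | no _ | yes refl = at-edge i (not w) w (subst (λ t → Joins t _ k i) (sym (not-⊙ w)) (negative (negJ₂ p)))
                         λ v → trans (eval (sgn w) (δ k v) (δ i v)) (cong (λ z → z * δ k v + sgn w * δ i v) (sym (sgn-not w)))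
    where
    w = T (neg i k p)
    eval : ∀ w x y → w * (y - x) ≡ - w * x + w * y
    eval = solve-∀
  ... | no k≢i | no k≢j = away (cong₂ _-_ (δ-≢ (k≢i ∘ sym)) (δ-≢ (k≢j ∘ sym)))
  incidence T k (pos i j p) with k ≟ᶠ i | k ≟ᶠ j
  ... | yes refl | _ = at-edge j w w (subst (λ t → Joins t _ k j) (sym (⊙-self w)) (positive (posJ₁ p)))
                         λ v → ℤ.*-distribˡ-+ (sgn w) (δ k v) (δ j v)
    where
    w = T (pos k j p)
  ... | no _ | yes refl = at-edge i w w (subst (λ t → Joins t _ k i) (sym (⊙-self w)) (positive (posJ₂ p)))
                         λ v → trans (ℤ.*-distribˡ-+ (sgn w) (δ i v) (δ k v)) (ℤ.+-comm (sgn w * δ i v) (sgn w * δ k v))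
    where
    w = T (pos i k p)
  ... | no k≢i | no k≢j = away (cong₂ _+_ (δ-≢ (k≢i ∘ sym)) (δ-≢ (k≢j ∘ sym)))
  incidence T k (half i) with k ≟ᶠ i
  ... | yes refl = at-half
  ... | no  k≢i  = away (δ-≢ (k≢i ∘ sym))
  incidence T k (loop i) with k ≟ᶠ i
  ... | yes refl = at-loop
  ... | no  k≢i  = away (cong (+ 2 *_) (δ-≢ (k≢i ∘ sym)))

  private
    unpos : ∀ {e a b} → Joins true e a b → PosJ e a b
    unpos (positive j) = j

  -- A triangle is a generator iff an odd number of its edges are negative (false).
  triangle : ∀ {Φ t₁ t₂ g₁ g₂ h} {k x y : Fin n} → Distinct3 k x y →
             Joins t₁ g₁ k x → Joins t₂ g₂ k y → Joins (t₁ xor t₂) h x y → Generator Φ g₁ g₂ h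
  triangle d (negative j₁) (negative j₂) (negative j₃) = record
    { games = _ ; shape = triNeg d j₁ j₂ j₃ ; games↭ = ↭-refl }
  triangle d (negative j₁) (positive j₂) (positive j₃) = record
    { games = _ ; shape = triMix d j₁ j₂ j₃ ; games↭ = ↭-refl }
  triangle (k≢x , k≢y , x≢y) (positive j₁) (negative j₂) J₃@(positive _) = record
    { games = _ ; shape = triMix (k≢y , k≢x , x≢y ∘ sym) j₂ j₁ (unpos (joins-sym J₃)) ; games↭ = ↭-swap _ _ ↭-refl }
  triangle (k≢x , k≢y , x≢y) J₁@(positive _) J₂@(positive _) (negative j₃) = record
    { games = _ ; shape = triMix (x≢y , k≢x ∘ sym , k≢y ∘ sym) j₃ (unpos (joins-sym J₁)) (unpos (joins-sym J₂))
    ; games↭ = ↭-sym (shift _ (_ ∷ _ ∷ []) []) }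

  half-generator : ∀ {t g} {a b : Fin n} → Joins t g a b → Generator B g (half a) (half b)
  half-generator J@(negative j) = record { games = _ ; shape = halfNeg (joins-≢ J) j ; games↭ = ↭-refl }
  half-generator J@(positive j) = record { games = _ ; shape = halfPos (joins-≢ J) j ; games↭ = ↭-refl }

  loop-generator₁ : ∀ {t g h} {a b : Fin n} → Joins t g a b → Joins (not t) h a b → Generator C g (loop a) h
  loop-generator₁ J@(negative j) (positive j′) = record
    { games = _ ; shape = loopC (joins-≢ J) j j′ ; games↭ = ↭-prep _ (↭-swap _ _ ↭-refl) }
  loop-generator₁ J@(positive j) (negative j′) = record
    { games = _ ; shape = loopC (joins-≢ J) j′ j ; games↭ = ↭-trans (↭-swap _ _ ↭-refl) (↭-prep _ (↭-swap _ _ ↭-refl)) }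

  loop-generator₂ : ∀ {t g h} {a b : Fin n} → Joins t g a b → Joins (not t) h a b → Generator C g h (loop a)
  loop-generator₂ J@(negative j) (positive j′) = record { games = _ ; shape = loopC (joins-≢ J) j j′ ; games↭ = ↭-refl }
  loop-generator₂ J@(positive j) (negative j′) = record
    { games = _ ; shape = loopC (joins-≢ J) j′ j ; games↭ = ↭-swap _ _ ↭-refl }

  reducer-or-∈ : ∀ {Φ} {T : Tournament n} {L g₁ g₂ h} → g₁ ∈ L → g₂ ∈ L → g₁ ≢ g₂ → h ≢ g₁ → h ≢ g₂ →
                 InK Φ h → Generator Φ g₁ g₂ h →
                 ∀ ε → (∀ v → svec T h v ≡ sgn ε * (svec T g₁ v + svec T g₂ v)) →
                 Reducer Φ T L ⊎ (h ∈ L × Replaces T h g₁ g₂)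
  reducer-or-∈ {T = T} {L} {g₁} {g₂} {h} g₁∈L g₂∈L g₁≢g₂ h≢g₁ h≢g₂ h∈K gen ε svec-h =
    decide ε svec-h (any? (h ≟E_) L)
    where
    reducer : Completes T h g₁ g₂ ⊎ (h ∉ L × Replaces T h g₁ g₂) → Reducer _ T L
    reducer closing = record { g₁∈L = g₁∈L ; g₂∈L = g₂∈L ; g₁≢g₂ = g₁≢g₂ ; h≢g₁ = h≢g₁ ; h≢g₂ = h≢g₂
                             ; h∈K = h∈K ; generator = gen ; closing = closing }
    decide : ∀ ε → (∀ v → svec T h v ≡ sgn ε * (svec T g₁ v + svec T g₂ v)) → Dec (h ∈ L) →
             Reducer _ T L ⊎ (h ∈ L × Replaces T h g₁ g₂)
    decide false svec-h _         = inj₁ (reducer (inj₁ λ v → trans (svec-h v) (ℤ.-1*i≡-i _)))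
    decide true  svec-h (yes h∈L) = inj₂ (h∈L , λ v → trans (svec-h v) (ℤ.*-identityˡ _))
    decide true  svec-h (no  h∉L) = inj₁ (reducer (inj₂ (h∉L , λ v → trans (svec-h v) (ℤ.*-identityˡ _))))

posPart : ℤ → ℕ
posPart (+ m)      = m
posPart -[1+ _ ]   = 0

posPart-split : ∀ z → z ≡ + posPart (sgn true * z) - + posPart (sgn false * z)
posPart-split z rewrite ℤ.*-identityˡ z | ℤ.-1*i≡-i z = split z
  where
  split : ∀ z → z ≡ + posPart z - + posPart (- z)
  split (+ 0)       = refl
  split (+ suc m)   = sym (ℤ.+-identityʳ _)
  split -[1+ m ]    = refl

same-sign : ∀ a b m → 1 ≤ posPart (sgn a * (sgn b * + suc m)) → b ≡ a
same-sign true  true  m _ = refl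
same-sign false false m _ = refl

posPart-sgn*sgn : ∀ a m → posPart (sgn a * (sgn a * + m)) ≡ m
posPart-sgn*sgn a m = cong posPart (sgn*sgn a (+ m))

module _ {n : ℕ} where

  weight : Tournament n → Bool → Fin n → Edge n → ℕ
  weight T s v e = posPart (sgn s * svec T e v)

  totalWeight : Tournament n → List (Edge n) → Bool → Fin n → ℕ
  totalWeight T L s v = sum (map (weight T s v) L)

  Σsvec-as-weights : ∀ (T : Tournament n) L v → Σsvec T L v ≡ + totalWeight T L true v - + totalWeight T L false v
  Σsvec-as-weights T []      v = refl
  Σsvec-as-weights T (e ∷ L) v = begin
    svec T e v + Σsvec T L v
      ≡⟨ cong₂ _+_ (posPart-split (svec T e v)) (Σsvec-as-weights T L v) ⟩
    (+ weight T true v e - + weight T false v e) + (+ totalWeight T L true v - + totalWeight T L false v)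
      ≡⟨ regroup (+ weight T true v e) (+ weight T false v e) (+ totalWeight T L true v) (+ totalWeight T L false v) ⟩
    (+ weight T true v e + + totalWeight T L true v) - (+ weight T false v e + + totalWeight T L false v)
      ≡⟨ cong₂ _-_ (ℤ.pos-+ (weight T true v e) _) (ℤ.pos-+ (weight T false v e) _) ⟨
    + totalWeight T (e ∷ L) true v - + totalWeight T (e ∷ L) false v ∎
    where
    open ≡-Reasoning
    regroup : ∀ a b c d → (a - b) + (c - d) ≡ (a + c) - (b + d)
    regroup = solve-∀

  totalWeight-balanced : ∀ {T : Tournament n} {L} → Neutral T L → ∀ s v → totalWeight T L s v ≡ totalWeight T L true v
  totalWeight-balanced                 neutral true  v = refl
  totalWeight-balanced {T} {L} neutral false v =
    sym (ℤ.+-injective (ℤ.i-j≡0⇒i≡j _ _ (trans (sym (Σsvec-as-weights T L v)) (neutral v))))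

  vec-positive : ∀ (e : Edge n) → ∃ λ v → 1 ≤ posPart (vec e v)
  vec-positive (neg i j p) =
    i , subst (λ z → 1 ≤ posPart z) (sym (cong₂ _-_ (δ-same i) (δ-≢ (joins-≢ (negative (negJ₁ p)) ∘ sym)))) (s≤s ℕ.z≤n)
  vec-positive (pos i j p) =
    i , subst (λ z → 1 ≤ posPart z) (sym (cong₂ _+_ (δ-same i) (δ-≢ (joins-≢ (positive (posJ₁ p)) ∘ sym)))) (s≤s ℕ.z≤n)
  vec-positive (half i)    = i , subst (λ z → 1 ≤ posPart z) (sym (δ-same i)) (s≤s ℕ.z≤n)
  vec-positive (loop i)    = i , subst (λ z → 1 ≤ posPart z) (sym (cong (+ 2 *_) (δ-same i))) (s≤s ℕ.z≤n)

  weight-at-own-sign : ∀ (T : Tournament n) e → ∃ λ v → 1 ≤ weight T (T e) v e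
  weight-at-own-sign T e with v , 1≤vec ← vec-positive e = v , subst (λ z → 1 ≤ posPart z) (sym (sgn*sgn (T e) (vec e v))) 1≤vec

module _ {n : ℕ} (T : Tournament n) where

  weight-≡ : ∀ e s {v m} → svec T e v ≡ sgn s * + m → weight T s v e ≡ m
  weight-≡ e s {m = m} svec-e = trans (cong (λ z → posPart (sgn s * z)) svec-e) (posPart-sgn*sgn s m)

  weight-away : ∀ {e s v} → vec e v ≡ + 0 → weight T s v e ≡ 0
  weight-away {e} {s} {v} vec≡0 = cong posPart (begin
    sgn s * (sgn (T e) * vec e v)  ≡⟨ cong (λ z → sgn s * (sgn (T e) * z)) vec≡0 ⟩
    sgn s * (sgn (T e) * + 0)      ≡⟨ cong (sgn s *_) (ℤ.*-zeroʳ (sgn (T e))) ⟩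
    sgn s * + 0                    ≡⟨ ℤ.*-zeroʳ (sgn s) ⟩
    + 0                            ∎)
    where open ≡-Reasoning

  weight-one-sided : ∀ {e v} → 1 ≤ weight T true v e → 1 ≤ weight T false v e → ⊥
  weight-one-sided {e} {v} rewrite ℤ.*-identityˡ (svec T e v) | ℤ.-1*i≡-i (svec T e v) = one-sided (svec T e v)
    where
    one-sided : ∀ z → 1 ≤ posPart z → 1 ≤ posPart (- z) → ⊥
    one-sided (+ suc _) _ ()
    one-sided -[1+ _ ] ()

module Pivot {n : ℕ} {Φ : Typ} {T : Tournament n} {L : List (Edge n)} (inK : All (InK Φ) L)
  {k x : Fin n} {σ α : Bool} {g₁ : Edge n} (g₁∈L : g₁ ∈ L) (j₁ : Joins (σ ⊙ α) g₁ k x)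
  (svec-g₁ : ∀ v → svec T g₁ v ≡ signedPair k σ x α v)
  where

  k≢x : k ≢ x
  k≢x = joins-≢ j₁

  -- f e: how strongly e points out of k against g₁;  g e: how strongly e points at x along g₁.
  f g : Edge n → ℕ
  f = weight T (not σ) k
  g = weight T α x

  Image : Edge n → Edge n → Set
  Image e h = h ∈ L × f e ≤ g h

  equal-weights : ∀ e h {m} → svec T e k ≡ sgn (not σ) * + m → svec T h x ≡ sgn α * + m → f e ≤ g h
  equal-weights e h e-at-k h-at-x = ℕ.≤-reflexive (trans (weight-≡ T e (not σ) e-at-k) (sym (weight-≡ T h α h-at-x)))

  sign-at-k : ∀ e s {m} → svec T e k ≡ sgn s * + suc m → 1 ≤ f e → s ≡ not σ
  sign-at-k e s {m} svec-e 1≤fe = same-sign (not σ) s m (subst (λ z → 1 ≤ posPart (sgn (not σ) * z)) svec-e 1≤fe)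

  g₁-at-k : svec T g₁ k ≡ sgn σ
  g₁-at-k = trans (svec-g₁ k) (signedPair-at-first σ α k≢x)

  g₁-at-x : svec T g₁ x ≡ sgn α
  g₁-at-x = trans (svec-g₁ x) (signedPair-at-second σ α k≢x)

  g₁≢ : ∀ {e} → 1 ≤ f e → g₁ ≢ e
  g₁≢ 1≤fe refl = not-¬ refl (sign-at-k g₁ σ (trans g₁-at-k (sgn-unit σ)) 1≤fe)

  far-edge-≢-g₁ : ∀ {t y} (x≢y : x ≢ y) → k ≢ y → edgeBetween t x y x≢y ≢ g₁
  far-edge-≢-g₁ {t} {y} x≢y k≢y h≡g₁
    with proj₂ (joins-ends (edgeBetween-joins t x y x≢y) (subst (λ z → Joins _ z k x) (sym h≡g₁) j₁))
  ... | inj₁ (x≡k , _) = k≢x (sym x≡k)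
  ... | inj₂ (_ , y≡k) = k≢y (sym y≡k)

  via-x : ∀ {e β} → 1 ≤ f e → Joins (not σ ⊙ β) e k x → (∀ v → svec T e v ≡ signedPair k (not σ) x β v) → f e ≤ g e
  via-x {e} {β} 1≤fe j svec-e with β Bool.≟ α
  ... | yes refl = equal-weights e e (trans (svec-e k) (trans (signedPair-at-first (not σ) α k≢x) (sgn-unit (not σ))))
                                     (trans (svec-e x) (trans (signedPair-at-second (not σ) α k≢x) (sgn-unit α)))
  ... | no β≢α   = ⊥-elim (g₁≢ 1≤fe (joins-unique j₁ (subst (λ t → Joins t e k x) type≡ j)))
    where
    type≡ : not σ ⊙ β ≡ σ ⊙ α
    type≡ = trans (cong (not σ ⊙_) (¬-not β≢α)) (not-⊙-not σ α)

  via-edge : ∀ {e y β} → e ∈ L → Joins (not σ ⊙ β) e k y → (∀ v → svec T e v ≡ signedPair k (not σ) y β v) →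
             (x≢y : x ≢ y) → Reducer Φ T L ⊎ Image e (edgeBetween (α ⊙ β) x y x≢y)
  via-edge {e} {y} {β} e∈L j svec-e x≢y =
    Sum.map₂ image (reducer-or-∈ g₁∈L e∈L g₁≢e (far-edge-≢-g₁ x≢y k≢y) h≢e (joins-InK jh) generator ε svec-h)
    where
    k≢y = joins-≢ j
    h = edgeBetween (α ⊙ β) x y x≢y
    jh = edgeBetween-joins (α ⊙ β) x y x≢y
    e-at-k : svec T e k ≡ sgn (not σ) * + 1
    e-at-k = trans (svec-e k) (trans (signedPair-at-first (not σ) β k≢y) (sgn-unit (not σ)))
    g₁≢e : g₁ ≢ e
    g₁≢e = g₁≢ (ℕ.≤-reflexive (sym (weight-≡ T e (not σ) e-at-k)))
    g₁+e : ∀ v → svec T g₁ v + svec T e v ≡ signedPair x α y β v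
    g₁+e v = begin
      svec T g₁ v + svec T e v
        ≡⟨ cong₂ _+_ (svec-g₁ v) (trans (svec-e v) (cong (λ z → z * δ k v + sgn β * δ y v) (sgn-not σ))) ⟩
      (sgn σ * δ k v + sgn α * δ x v) + (- sgn σ * δ k v + sgn β * δ y v)
        ≡⟨ cancel (sgn σ) (sgn α) (sgn β) (δ k v) (δ x v) (δ y v) ⟩
      signedPair x α y β v ∎
      where
      open ≡-Reasoning
      cancel : ∀ s a b dk dx dy → (s * dk + a * dx) + (- s * dk + b * dy) ≡ a * dx + b * dy
      cancel = solve-∀
    ε = proj₁ (svec-joins T {α} {β} jh)
    svec-h : ∀ v → svec T h v ≡ sgn ε * (svec T g₁ v + svec T e v)
    svec-h v = trans (proj₂ (svec-joins T {α} {β} jh) v) (cong (sgn ε *_) (sym (g₁+e v)))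
    generator : Generator Φ g₁ e h
    generator = triangle (k≢x , k≢y , x≢y) j₁ j (subst (λ t → Joins t h x y) (⊙-xor σ α β) jh)
    h≢e : h ≢ e
    h≢e h≡e with proj₂ (joins-ends jh (subst (λ z → Joins _ z k y) (sym h≡e) j))
    ... | inj₁ (x≡k , _) = k≢x (sym x≡k)
    ... | inj₂ (x≡y , _) = x≢y x≡y
    image : h ∈ L × Replaces T h g₁ e → Image e h
    image (h∈L , replaces) =
      h∈L , equal-weights e h e-at-k (trans (replaces x) (trans (g₁+e x) (trans (signedPair-at-first α β x≢y) (sgn-unit α))))

  via-half : half k ∈ L → 1 ≤ f (half k) → Reducer Φ T L ⊎ Image (half k) (half x)
  via-half hk∈L 1≤f = Sum.map₂ image
    (reducer-or-∈ g₁∈L hk∈L (joins-≢-half j₁) (joins-≢-half j₁ ∘ sym) (k≢x ∘ sym ∘ half-injective)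
                  (subst (λ Φ → InK Φ (half x)) (sym Φ≡B) inK-half) generator (T (half x) ⊙ α) svec-hx)
    where
    Φ≡B : Φ ≡ B
    Φ≡B = InK-half (All.lookup inK hk∈L)
    generator : Generator Φ g₁ (half k) (half x)
    generator = subst (λ Φ → Generator Φ g₁ (half k) (half x)) (sym Φ≡B) (half-generator j₁)
    svec-hk : ∀ v → svec T (half k) v ≡ sgn (not σ) * δ k v
    svec-hk v = cong (λ b → sgn b * δ k v) (sign-at-k (half k) (T (half k)) (cong (sgn (T (half k)) *_) (δ-same k)) 1≤f)
    g₁+hk : ∀ v → svec T g₁ v + svec T (half k) v ≡ sgn α * δ x v
    g₁+hk v = trans (cong₂ _+_ (svec-g₁ v) (trans (svec-hk v) (cong (_* δ k v) (sgn-not σ))))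
                    (cancel (sgn σ) (sgn α) (δ k v) (δ x v))
      where
      cancel : ∀ s a dk dx → (s * dk + a * dx) + - s * dk ≡ a * dx
      cancel = solve-∀
    svec-hx : ∀ v → svec T (half x) v ≡ sgn (T (half x) ⊙ α) * (svec T g₁ v + svec T (half k) v)
    svec-hx v = trans (sgn-factor (T (half x)) α (δ x v)) (cong (sgn (T (half x) ⊙ α) *_) (sym (g₁+hk v)))
    image : half x ∈ L × Replaces T (half x) g₁ (half k) → Image (half k) (half x)
    image (hx∈L , replaces) = hx∈L , equal-weights (half k) (half x)
      (trans (svec-hk k) (cong (sgn (not σ) *_) (δ-same k)))
      (trans (replaces x) (trans (g₁+hk x) (cong (sgn α *_) (δ-same x))))

  twin : Edge n
  twin = edgeBetween (not σ ⊙ α) k x k≢x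

  twin-joins : Joins (not (σ ⊙ α)) twin k x
  twin-joins = subst (λ t → Joins t twin k x) (not-⊙ˡ σ α) (edgeBetween-joins (not σ ⊙ α) k x k≢x)

  twin≢g₁ : twin ≢ g₁
  twin≢g₁ twin≡g₁ = not-¬ refl (sym (proj₁ (joins-ends twin-joins (subst (λ z → Joins (σ ⊙ α) z k x) (sym twin≡g₁) j₁))))

  module _ (lk∈L : loop k ∈ L) (1≤f : 1 ≤ f (loop k)) where

    Φ≡C : Φ ≡ C
    Φ≡C = InK-loop (All.lookup inK lk∈L)

    svec-lk : ∀ v → svec T (loop k) v ≡ - sgn σ * (+ 2 * δ k v)
    svec-lk v = trans (cong (λ b → sgn b * (+ 2 * δ k v)) (sign-at-k (loop k) (T (loop k)) lk-at-k 1≤f))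
                      (cong (_* (+ 2 * δ k v)) (sgn-not σ))
      where
      lk-at-k : svec T (loop k) k ≡ sgn (T (loop k)) * + 2
      lk-at-k = cong (λ d → sgn (T (loop k)) * (+ 2 * d)) (δ-same k)

    via-loop-twin : twin ∈ L → Replaces T twin g₁ (loop k) → Reducer Φ T L ⊎ Image (loop k) (loop x)
    via-loop-twin twin∈L replaces₁ = Sum.map₂ image
      (reducer-or-∈ g₁∈L twin∈L (twin≢g₁ ∘ sym) (joins-≢-loop j₁ ∘ sym) (joins-≢-loop twin-joins ∘ sym)
                    (subst (λ Φ → InK Φ (loop x)) (sym Φ≡C) inK-loop) generator (T (loop x) ⊙ α) svec-lx)
      where
      generator : Generator Φ g₁ twin (loop x)
      generator = subst (λ Φ → Generator Φ g₁ twin (loop x)) (sym Φ≡C) (loop-generator₂ (joins-sym j₁) (joins-sym twin-joins))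
      g₁+twin : ∀ v → svec T g₁ v + svec T twin v ≡ sgn α * (+ 2 * δ x v)
      g₁+twin v = begin
        svec T g₁ v + svec T twin v
          ≡⟨ cong (λ z → svec T g₁ v + z) (replaces₁ v) ⟩
        svec T g₁ v + (svec T g₁ v + svec T (loop k) v)
          ≡⟨ cong₂ (λ p q → p + (p + q)) (svec-g₁ v) (svec-lk v) ⟩
        (sgn σ * δ k v + sgn α * δ x v) + ((sgn σ * δ k v + sgn α * δ x v) + - sgn σ * (+ 2 * δ k v))
          ≡⟨ cancel (sgn σ) (sgn α) (δ k v) (δ x v) ⟩
        sgn α * (+ 2 * δ x v) ∎
        where
        open ≡-Reasoning
        cancel : ∀ s a dk dx → (s * dk + a * dx) + ((s * dk + a * dx) + - s * (+ 2 * dk)) ≡ a * (+ 2 * dx)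
        cancel = solve-∀
      svec-lx : ∀ v → svec T (loop x) v ≡ sgn (T (loop x) ⊙ α) * (svec T g₁ v + svec T twin v)
      svec-lx v = trans (sgn-factor (T (loop x)) α (+ 2 * δ x v)) (cong (sgn (T (loop x) ⊙ α) *_) (sym (g₁+twin v)))
      image : loop x ∈ L × Replaces T (loop x) g₁ twin → Image (loop k) (loop x)
      image (lx∈L , replaces₂) = lx∈L , equal-weights (loop k) (loop x)
        (trans (svec-lk k) (trans (cong (λ d → - sgn σ * (+ 2 * d)) (δ-same k)) (cong (_* + 2) (sym (sgn-not σ)))))
        (trans (replaces₂ x) (trans (g₁+twin x) (cong (λ d → sgn α * (+ 2 * d)) (δ-same x))))

    via-loop : Reducer Φ T L ⊎ Image (loop k) (loop x)
    via-loop = [ inj₁ , uncurry via-loop-twin ]′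
      (reducer-or-∈ g₁∈L lk∈L (joins-≢-loop j₁) twin≢g₁ (joins-≢-loop twin-joins) (joins-InK twin-joins) generator ε svec-twin)
      where
      generator : Generator Φ g₁ (loop k) twin
      generator = subst (λ Φ → Generator Φ g₁ (loop k) twin) (sym Φ≡C) (loop-generator₁ j₁ twin-joins)
      g₁+lk : ∀ v → svec T g₁ v + svec T (loop k) v ≡ signedPair k (not σ) x α v
      g₁+lk v = begin
        svec T g₁ v + svec T (loop k) v
          ≡⟨ cong₂ _+_ (svec-g₁ v) (svec-lk v) ⟩
        (sgn σ * δ k v + sgn α * δ x v) + - sgn σ * (+ 2 * δ k v)
          ≡⟨ cancel (sgn σ) (sgn α) (δ k v) (δ x v) ⟩
        - sgn σ * δ k v + sgn α * δ x v
          ≡⟨ cong (λ z → z * δ k v + sgn α * δ x v) (sgn-not σ) ⟨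
        signedPair k (not σ) x α v ∎
        where
        open ≡-Reasoning
        cancel : ∀ s a dk dx → (s * dk + a * dx) + - s * (+ 2 * dk) ≡ - s * dk + a * dx
        cancel = solve-∀
      ε = proj₁ (svec-joins T {not σ} {α} (edgeBetween-joins (not σ ⊙ α) k x k≢x))
      svec-twin : ∀ v → svec T twin v ≡ sgn ε * (svec T g₁ v + svec T (loop k) v)
      svec-twin v = trans (proj₂ (svec-joins T {not σ} {α} (edgeBetween-joins (not σ ⊙ α) k x k≢x)) v)
                          (cong (sgn ε *_) (sym (g₁+lk v)))

  target : ∀ e → Incidence T k e → Edge n
  target e (at-edge y _ β _ _) with x ≟ᶠ y
  ... | yes _   = e
  ... | no  x≢y = edgeBetween (α ⊙ β) x y x≢y
  target _ at-half  = half x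
  target _ at-loop  = loop x
  target e (away _) = e

  edge-sign : ∀ {e y} s β → Joins (s ⊙ β) e k y → (∀ v → svec T e v ≡ signedPair k s y β v) → 1 ≤ f e → s ≡ not σ
  edge-sign {e} s β j svec-e = sign-at-k e s (trans (svec-e k) (trans (signedPair-at-first s β (joins-≢ j)) (sgn-unit s)))

  away-empty : ∀ {e} → vec e k ≡ + 0 → 1 ≤ f e → ⊥
  away-empty {e} vec≡0 1≤fe = ℕ.n≮0 (subst (1 ≤_) (weight-away T {e} {not σ} vec≡0) 1≤fe)

  analyse : ∀ {e} → e ∈ L → 1 ≤ f e → (i : Incidence T k e) → Reducer Φ T L ⊎ Image e (target e i)
  analyse e∈L 1≤fe (at-edge y s β j svec-e) with edge-sign s β j svec-e 1≤fe
  ... | refl with x ≟ᶠ y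
  ...   | yes refl = inj₂ (e∈L , via-x 1≤fe j svec-e)
  ...   | no  x≢y  = via-edge e∈L j svec-e x≢y
  analyse e∈L 1≤fe at-half      = via-half e∈L 1≤fe
  analyse e∈L 1≤fe at-loop      = via-loop e∈L 1≤fe
  analyse e∈L 1≤fe (away vec≡0) = ⊥-elim (away-empty vec≡0 1≤fe)

  target-edge-joins : ∀ {e y} s β (j : Joins (s ⊙ β) e k y) eq → ∃₂ λ t z → Joins t (target e (at-edge y s β j eq)) x z
  target-edge-joins {y = y} s β j eq with x ≟ᶠ y
  ... | yes refl = _ , k , joins-sym j
  ... | no  x≢y  = _ , y , edgeBetween-joins _ x y x≢y

  target-≢-g₁ : ∀ {e} → 1 ≤ f e → (i : Incidence T k e) → target e i ≢ g₁
  target-≢-g₁ 1≤fe (at-edge y s β j eq) with x ≟ᶠ y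
  ... | yes _   = g₁≢ 1≤fe ∘ sym
  ... | no  x≢y = far-edge-≢-g₁ x≢y (joins-≢ j)
  target-≢-g₁ 1≤fe at-half      = joins-≢-half j₁ ∘ sym
  target-≢-g₁ 1≤fe at-loop      = joins-≢-loop j₁ ∘ sym
  target-≢-g₁ 1≤fe (away vec≡0) = ⊥-elim (away-empty vec≡0 1≤fe)

  k-x-edge-≢-far-edge : ∀ {t t′ e y′} → Joins t e k x → k ≢ y′ → (x≢y′ : x ≢ y′) → e ≢ edgeBetween t′ x y′ x≢y′
  k-x-edge-≢-far-edge j k≢y′ x≢y′ e≡h
    with proj₂ (joins-ends j (subst (λ z → Joins _ z x _) (sym e≡h) (edgeBetween-joins _ x _ x≢y′)))
  ... | inj₁ (k≡x , _)  = k≢x k≡x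
  ... | inj₂ (k≡y′ , _) = k≢y′ k≡y′

  edge-targets-injective : ∀ {e e′ y y′ β β′} (j : Joins (not σ ⊙ β) e k y) (j′ : Joins (not σ ⊙ β′) e′ k y′) eq eq′ →
                           target e (at-edge y (not σ) β j eq) ≡ target e′ (at-edge y′ (not σ) β′ j′ eq′) → e ≡ e′
  edge-targets-injective {e} {e′} {y} {y′} {β} {β′} j j′ _ _ with x ≟ᶠ y | x ≟ᶠ y′
  ... | yes _    | yes _    = λ e≡e′ → e≡e′
  ... | yes refl | no x≢y′  = ⊥-elim ∘ k-x-edge-≢-far-edge j (joins-≢ j′) x≢y′
  ... | no x≢y   | yes refl = ⊥-elim ∘ k-x-edge-≢-far-edge j′ (joins-≢ j) x≢y ∘ sym
  ... | no x≢y   | no x≢y′  = λ h≡h′ → far (joins-ends (edgeBetween-joins _ x y x≢y)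
                                              (subst (λ z → Joins _ z x y′) (sym h≡h′) (edgeBetween-joins _ x y′ x≢y′)))
    where
    far : α ⊙ β ≡ α ⊙ β′ × SameEnds x y x y′ → e ≡ e′
    far (types≡ , inj₁ (_ , y≡y′)) =
      joins-unique j (subst₂ (λ b z → Joins (not σ ⊙ b) e′ k z) (sym (⊙-cancelˡ α types≡)) (sym y≡y′) j′)
    far (_ , inj₂ (x≡y′ , _))      = ⊥-elim (x≢y′ x≡y′)

  target-injective : ∀ {e e′} → 1 ≤ f e → 1 ≤ f e′ → (i : Incidence T k e) (i′ : Incidence T k e′) →
                     target e i ≡ target e′ i′ → e ≡ e′
  target-injective 1≤fe _ (away vec≡0) _ = ⊥-elim (away-empty vec≡0 1≤fe)
  target-injective _ 1≤fe′ _ (away vec≡0) = ⊥-elim (away-empty vec≡0 1≤fe′)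
  target-injective 1≤fe 1≤fe′ (at-edge _ s β j eq) (at-edge _ s′ β′ j′ eq′)
    with edge-sign s β j eq 1≤fe | edge-sign s′ β′ j′ eq′ 1≤fe′
  ... | refl | refl = edge-targets-injective j j′ eq eq′
  target-injective _ _ (at-edge _ s β j eq) at-half = ⊥-elim ∘ joins-≢-half (proj₂ (proj₂ (target-edge-joins s β j eq)))
  target-injective _ _ (at-edge _ s β j eq) at-loop = ⊥-elim ∘ joins-≢-loop (proj₂ (proj₂ (target-edge-joins s β j eq)))
  target-injective _ _ at-half (at-edge _ s β j eq) = ⊥-elim ∘ joins-≢-half (proj₂ (proj₂ (target-edge-joins s β j eq))) ∘ sym
  target-injective _ _ at-loop (at-edge _ s β j eq) = ⊥-elim ∘ joins-≢-loop (proj₂ (proj₂ (target-edge-joins s β j eq))) ∘ sym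
  target-injective _ _ at-half at-half _ = refl
  target-injective _ _ at-loop at-loop _ = refl
  target-injective _ _ at-half at-loop ()
  target-injective _ _ at-loop at-half ()

  ψ : Edge n → Edge n
  ψ e = target e (incidence T k e)

  images : ∀ {e} → e ∈ L → Reducer Φ T L ⊎ (1 ≤ f e → Image e (ψ e))
  images {e} e∈L with 1 ≤? f e
  ... | no  1≰fe = inj₂ (⊥-elim ∘ 1≰fe)
  ... | yes 1≤fe = Sum.map₂ (λ image _ → image) (analyse e∈L 1≤fe (incidence T k e))

  reducer : Unique L → Neutral T L → (∀ v → totalWeight T L true v ≤ totalWeight T L true k) → Reducer Φ T L
  reducer unique neutral k-max with first-or-all L images
  ... | inj₁ r     = r
  ... | inj₂ image = ⊥-elim (ℕ.n≮n (totalWeight T L true k) (begin-strict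
    totalWeight T L true k   ≡⟨ totalWeight-balanced {T = T} {L} neutral (not σ) k ⟨
    sum (map f L)            ≤⟨ sum-≤-by-injection f g ψ unique image′ injective ⟩
    sum (map g M)            <⟨ ℕ.n<1+n _ ⟩
    suc (sum (map g M))      ≡⟨ cong (ℕ._+ sum (map g M)) (weight-≡ T g₁ α (trans g₁-at-x (sgn-unit α))) ⟨
    g g₁ ℕ.+ sum (map g M)   ≡⟨ sum-↭ (map⁺ g L↭) ⟨
    totalWeight T L α x      ≡⟨ totalWeight-balanced {T = T} {L} neutral α x ⟩
    totalWeight T L true x   ≤⟨ k-max x ⟩
    totalWeight T L true k   ∎))
    where
    open ℕ.≤-Reasoning
    M = proj₁ (∈⇒↭∷ g₁∈L)
    L↭ = proj₂ (∈⇒↭∷ g₁∈L)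
    image′ : ∀ {e} → e ∈ L → 1 ≤ f e → ψ e ∈ M × f e ≤ g (ψ e)
    image′ {e} e∈L 1≤fe with image e∈L 1≤fe
    ... | ψe∈L , fe≤ with ∈-resp-↭ L↭ ψe∈L
    ...   | here ψe≡g₁  = ⊥-elim (target-≢-g₁ 1≤fe (incidence T k e) ψe≡g₁)
    ...   | there ψe∈M = ψe∈M , fe≤
    injective : ∀ {e e′} → e ∈ L → e′ ∈ L → 1 ≤ f e → 1 ≤ f e′ → ψ e ≡ ψ e′ → e ≡ e′
    injective {e} {e′} _ _ 1≤fe 1≤fe′ = target-injective 1≤fe 1≤fe′ (incidence T k e) (incidence T k e′)

heaviest-vertex : ∀ {n} (T : Tournament n) e L → Neutral T (e ∷ L) →
                  ∃ λ k → (∀ v → totalWeight T (e ∷ L) true v ≤ totalWeight T (e ∷ L) true k)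
                        × (∀ s → 1 ≤ totalWeight T (e ∷ L) s k)
heaviest-vertex {n} T e L neutral = k , k-max , 1≤W
  where
  W : Bool → Fin n → ℕ
  W = totalWeight T (e ∷ L)
  v₀ = proj₁ (weight-at-own-sign T e)
  k = argmax (W true) v₀ (allFin n)
  k-max : ∀ v → W true v ≤ W true k
  k-max v = All.lookup (f[xs]≤f[argmax] v₀ (allFin n)) (∈-allFin v)
  1≤W : ∀ s → 1 ≤ W s k
  1≤W s = begin
    1                      ≤⟨ proj₂ (weight-at-own-sign T e) ⟩
    weight T (T e) v₀ e    ≤⟨ ℕ.m≤m+n _ _ ⟩
    W (T e) v₀             ≡⟨ totalWeight-balanced {T = T} {e ∷ L} neutral (T e) v₀ ⟩
    W true v₀              ≤⟨ k-max v₀ ⟩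
    W true k               ≡⟨ totalWeight-balanced {T = T} {e ∷ L} neutral s k ⟨
    W s k                  ∎
    where open ℕ.≤-Reasoning

module _ {n : ℕ} {Φ : Typ} {T : Tournament n} {L : List (Edge n)}
         (unique : Unique L) (inK : All (InK Φ) L) (neutral : Neutral T L)
         {k : Fin n} (k-max : ∀ v → totalWeight T L true v ≤ totalWeight T L true k)
  where

  private
    from-edge : ∀ {g₁ y} s β → g₁ ∈ L → Joins (s ⊙ β) g₁ k y → (∀ v → svec T g₁ v ≡ signedPair k s y β v) →
                Reducer Φ T L
    from-edge s β g₁∈L j svec-g₁ = Pivot.reducer inK {σ = s} {α = β} g₁∈L j svec-g₁ unique neutral k-max

    from-negative : ∀ {g} → g ∈ L → 1 ≤ weight T false k g → Incidence T k g →
                    ∀ {h} → h ∈ L → 1 ≤ weight T true k h → h ≡ half k ⊎ h ≡ loop k → Reducer Φ T L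
    from-negative g∈L _ (at-edge _ s β j svec-g) _ _ _ = from-edge s β g∈L j svec-g
    from-negative {g} _ 1≤wg (away vec≡0) _ _ _ = ⊥-elim (ℕ.n≮0 (subst (1 ≤_) (weight-away T {g} {false} vec≡0) 1≤wg))
    from-negative _ 1≤wg at-half _ 1≤wh (inj₁ refl) = ⊥-elim (weight-one-sided T 1≤wh 1≤wg)
    from-negative g∈L _ at-half h∈L _ (inj₂ refl) = ⊥-elim (half≢loop (All.lookup inK g∈L) (All.lookup inK h∈L))
    from-negative g∈L _ at-loop h∈L _ (inj₁ refl) = ⊥-elim (half≢loop (All.lookup inK h∈L) (All.lookup inK g∈L))
    from-negative _ 1≤wg at-loop _ 1≤wh (inj₂ refl) = ⊥-elim (weight-one-sided T 1≤wh 1≤wg)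

    from-positive : ∀ {h} → h ∈ L → 1 ≤ weight T true k h → Incidence T k h →
                    ∀ {g} → g ∈ L → 1 ≤ weight T false k g → Reducer Φ T L
    from-positive h∈L _ (at-edge _ s β j svec-h) _ _ = from-edge s β h∈L j svec-h
    from-positive {h} _ 1≤wh (away vec≡0) _ _ = ⊥-elim (ℕ.n≮0 (subst (1 ≤_) (weight-away T {h} {true} vec≡0) 1≤wh))
    from-positive h∈L 1≤wh at-half {g} g∈L 1≤wg = from-negative g∈L 1≤wg (incidence T k g) h∈L 1≤wh (inj₁ refl)
    from-positive h∈L 1≤wh at-loop {g} g∈L 1≤wg = from-negative g∈L 1≤wg (incidence T k g) h∈L 1≤wh (inj₂ refl)

  -- One of the two games is an edge at k: a game cannot point both ways at k, and half edges and loops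
  -- never occur together.
  reducer-at : ∀ {h g} → h ∈ L → 1 ≤ weight T true k h → g ∈ L → 1 ≤ weight T false k g → Reducer Φ T L
  reducer-at {h} h∈L 1≤wh = from-positive h∈L 1≤wh (incidence T k h)

reducer-exists : ∀ {n Φ} {T : Tournament n} {e L} → Unique (e ∷ L) → All (InK Φ) (e ∷ L) → Neutral T (e ∷ L) →
                 Reducer Φ T (e ∷ L)
reducer-exists {T = T} {e} {L} unique inK neutral
  with k , k-max , 1≤W ← heaviest-vertex T e L neutral
  with h , h∈L , 1≤wh ← sum-positive (weight T true k) (e ∷ L) (1≤W true)
  with g , g∈L , 1≤wg ← sum-positive (weight T false k) (e ∷ L) (1≤W false)
  = reducer-at unique inK neutral k-max h∈L 1≤wh g∈L 1≤wg

reversible : ∀ {n} Φ (T : Tournament n) L → Unique L → All (InK Φ) L → Neutral T L → Reversible Φ T L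
reversible {n} Φ T L = go T L (<-wellFounded (length L))
  where
  go : ∀ (T : Tournament n) L → Acc _<_ (length L) → Unique L → All (InK Φ) L → Neutral T L → Reversible Φ T L
  go T []      _         _      _   _       = 0 , done (λ _ → refl) , inj₁ (refl , refl)
  go T (e ∷ L) (acc rec) unique inK neutral =
    reduce unique inK neutral (λ T′ L′ shorter → go T′ L′ (rec shorter)) (reducer-exists unique inK neutral)

lemma13 : (Φ : Typ) (n : ℕ) (T : Tournament n) (I : List (Edge n)) →
          Unique I → All (InK Φ) I → Neutral T I → 3 ≤ length I →
          Σ ℕ (λ m → (m ≤ length I ∸ 2) × Reversals Φ T (T ✶ I) m)
lemma13 Φ n T I unique inK neutral 3≤I with reversible Φ T I unique inK neutral
... | m , r , inj₁ (I≡0 , _) = ⊥-elim (ℕ.n≮0 (subst (2 <_) I≡0 3≤I))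
... | m , r , inj₂ 2+m≤I    = m , subst (_≤ length I ∸ 2) (ℕ.m+n∸m≡n 2 m) (ℕ.∸-monoˡ-≤ 2 2+m≤I) , r
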